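{- There exists a planar triangle-free graph with $164$ vertices which is not $3$-choosable.
   Context: All graphs are finite, undirected and simple. A graph $G=(V,E)$ is $k$-choosable if for every assignment of sets $S(v)\subseteq\mathbb{Z}$ with $|S(v)|=k$ for all $v\in V$, there is a proper vertex coloring $c:V\to\mathbb{Z}$ with $c(v)\in S(v)$ for all $v\in V$. -}

module Defs where

open import Data.Nat using (ℕ)
open import Data.Fin using (Fin)
open import Data.Bool using (Bool; true; false)
open import Data.Integer using (ℤ)
open import Data.Rational using (ℚ; 0ℚ; 1ℚ; _≤_; _+_; _-_; _*_)
open import Data.Product using (_×_; _,_; Σ; ∃; ∃-syntax; proj₁; proj₂)
open import Data.List using (List; length)
open import Data.List.Membership.Propositional using (_∈_)
open import Data.List.Relation.Unary.Unique.Propositional using (Unique)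
open import Relation.Binary.PropositionalEquality using (_≡_; _≢_)
open import Relation.Nullary using (¬_)
open import Data.Empty using (⊥)

record Graph (n : ℕ) : Set where
  field
    adj    : Fin n → Fin n → Bool
    adj-sym    : ∀ u v → adj u v ≡ adj v u
    adj-irrefl : ∀ v → adj v v ≡ false

open Graph public

Adj : ∀ {n} → Graph n → Fin n → Fin n → Set
Adj G u v = adj G u v ≡ true

-- No three pairwise adjacent vertices (distinctness is automatic by irreflexivity).
TriangleFree : ∀ {n} → Graph n → Set
TriangleFree G = ∀ u v w → Adj G u v → Adj G v w → Adj G u w → ⊥

-- k-choosability: for every assignment of k-element sets S(v) ⊆ ℤ
-- (sets represented as duplicate-free lists of length k) there is a
-- proper colouring c with c(v) ∈ S(v).
ProperColouring : ∀ {n} → Graph n → (Fin n → ℤ) → Set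
ProperColouring G c = ∀ u v → Adj G u v → c u ≢ c v

Choosable : ℕ → ∀ {n} → Graph n → Set
Choosable k {n} G =
  (S : Fin n → List ℤ) →
  (∀ v → length (S v) ≡ k) →
  (∀ v → Unique (S v)) →
  ∃[ c ] (ProperColouring G c × (∀ v → c v ∈ S v))

Point : Set
Point = ℚ × ℚ

OnSegment : Point → Point → Point → Set
OnSegment (a₁ , a₂) (b₁ , b₂) (p₁ , p₂) =
  ∃[ t ] (0ℚ ≤ t × t ≤ 1ℚ ×
          p₁ ≡ a₁ + t * (b₁ - a₁) × p₂ ≡ a₂ + t * (b₂ - a₂))

-- A straight-line plane drawing of G: distinct vertices go to distinct
-- points, no vertex lies on an edge it is not an endpoint of, and edges
-- with four distinct endpoints do not meet.  (Together these say the
-- closed edge segments meet only in common endpoints.)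
record StraightLineEmbedding {n} (G : Graph n) : Set where
  field
    pos        : Fin n → Point
    pos-inj    : ∀ u v → pos u ≡ pos v → u ≡ v
    vertex-off : ∀ u v w → Adj G u v → w ≢ u → w ≢ v →
                 ¬ OnSegment (pos u) (pos v) (pos w)
    no-cross   : ∀ u v x y → Adj G u v → Adj G x y →
                 x ≢ u → x ≢ v → y ≢ u → y ≢ v →
                 ¬ (∃[ p ] (OnSegment (pos u) (pos v) p × OnSegment (pos x) (pos y) p))

-- Planar: admits a plane drawing; by Fáry's theorem, equivalently a
-- straight-line one.
Planar : ∀ {n} → Graph n → Set
Planar G = StraightLineEmbedding G

-- The graph consists of two roots x and y, with lists {0,1,2} and {3,4,5}, and, for each of the
-- nine pairs (i , j) of their possible colours, a 14-vertex gadget attached to x and y whose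
-- lists cannot be completed once x is coloured i and y is coloured j; 36 isolated vertices pad
-- it to 164 vertices.  Branching on the colours of x and y and searching the gadgets therefore
-- refutes every list colouring.
-- Planarity is witnessed by a straight-line drawing with integer coordinates in which each edge
-- is separated from every vertex and every edge it does not touch by the line through one of
-- the two: an affine function positive at both ends of one segment and non-positive at both
-- ends of the other keeps these signs along the segments, so they cannot meet.
-- Triangle-freeness follows from a homomorphism onto the 5-cycle.

module Submission where

open import Defs
open import Data.Nat using (ℕ)
open import Data.Product using (∃-syntax; _×_)
open import Relation.Nullary using (¬_)

open import Data.Bool as Bool using (Bool; true; false; T; not; _∧_; _∨_)
open import Data.Bool.ListAction using (all; any; or)
open import Data.Bool.Properties using (T-∧; T-∨; T-≡; ∨-comm)
open import Data.Empty using (⊥)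
open import Data.Fin using (Fin; toℕ; #_)
import Data.Fin.Properties as Fin
open import Data.Fin.Properties using (toℕ-injective; toℕ<n)
open import Data.Integer as ℤ using (ℤ; +_)
import Data.Integer.Properties as ℤ
import Data.Integer.Solver as ℤ-Solver
open import Data.List using (List; []; _∷_; _++_; map; head; drop; take; takeWhile; length; concat; replicate; applyUpTo; upTo; allFin)
open import Data.List.Membership.Propositional using (_∈_; find)
open import Data.List.Properties using (map-cong)
open import Data.List.Relation.Unary.All as All using (All; []; _∷_)
open import Data.List.Relation.Unary.All.Properties using (all⁺; all⁻)
open import Data.List.Relation.Unary.AllPairs using (AllPairs; _∷_; allPairs?)
open import Data.List.Relation.Unary.Any as Any using (here; there)
open import Data.List.Relation.Unary.Any.Properties using (any⁺; any⁻)
open import Data.List.Relation.Unary.Unique.Propositional using (Unique)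
import Data.List.Relation.Unary.Unique.DecPropositional
open import Data.Maybe using (fromMaybe)
import Data.Nat as ℕ
import Data.Nat.Properties as ℕ
open import Data.Nat.Properties using (allUpTo?)
open import Data.Product using (_,_; proj₁; proj₂)
open import Data.Product.Properties using (≡-dec)
open import Data.Rational using (ℚ; 0ℚ; 1ℚ; _+_; _*_; _-_; -_; _≤_; _<_; *≤*; *<*; nonNegative)
open import Data.Rational.Literals using (fromℤ)
open import Data.Rational.Properties
open import Data.Rational.Solver using (module +-*-Solver)
import Data.Rational.Unnormalised as ℚᵘ
import Data.Rational.Unnormalised.Properties as ℚᵘ
open import Data.Sum as Sum using (_⊎_; inj₁; inj₂; [_,_]′)
open import Function using (_∘_; flip)
open import Function.Bundles using (Equivalence)
open import Relation.Binary.PropositionalEquality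
open import Relation.Nullary using (Dec; does; yes; no; ¬?)
open import Relation.Nullary.Decidable using (_×-dec_; _⊎-dec_; _→-dec_; toWitness; dec-false; T?)

-- Segments with integer endpoints

IntPoint : Set
IntPoint = ℤ × ℤ

embed : IntPoint → Point
embed (x , y) = fromℤ x , fromℤ y

Affine : Set
Affine = ℤ × ℤ × ℤ

evalℤ : Affine → IntPoint → ℤ
evalℤ (a , b , c) (x , y) = a ℤ.* x ℤ.+ b ℤ.* y ℤ.+ c

evalℚ : Affine → Point → ℚ
evalℚ (a , b , c) (x , y) = fromℤ a * x + fromℤ b * y + fromℤ c

fromℤ-+ : ∀ m n → fromℤ (m ℤ.+ n) ≡ fromℤ m + fromℤ n
fromℤ-+ m n = toℚᵘ-injective
  (ℚᵘ.≃-trans (ℚᵘ.*≡* (ℤ-Solver.+-*-Solver.solve 2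
                 (λ m n → (m :+ n) :* con (+ 1) := (m :* con (+ 1) :+ n :* con (+ 1)) :* con (+ 1)) refl m n))
              (ℚᵘ.≃-sym (toℚᵘ-homo-+ (fromℤ m) (fromℤ n))))
  where open ℤ-Solver.+-*-Solver

fromℤ-* : ∀ m n → fromℤ (m ℤ.* n) ≡ fromℤ m * fromℤ n
fromℤ-* m n = toℚᵘ-injective (ℚᵘ.≃-trans (ℚᵘ.*≡* refl) (ℚᵘ.≃-sym (toℚᵘ-homo-* (fromℤ m) (fromℤ n))))

fromℤ-injective : ∀ {m n} → fromℤ m ≡ fromℤ n → m ≡ n
fromℤ-injective = cong ℚ.numerator

embed-injective : ∀ {p q} → embed p ≡ embed q → p ≡ q
embed-injective eq = cong₂ _,_ (fromℤ-injective (cong proj₁ eq)) (fromℤ-injective (cong proj₂ eq))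

fromℤ-pos : ∀ {n} → ℤ.0ℤ ℤ.< n → 0ℚ < fromℤ n
fromℤ-pos {n} 0<n = *<* (subst (ℤ.0ℤ ℤ.<_) (sym (ℤ.*-identityʳ n)) 0<n)

fromℤ-nonPos : ∀ {n} → n ℤ.≤ ℤ.0ℤ → fromℤ n ≤ 0ℚ
fromℤ-nonPos {n} n≤0 = *≤* (subst (ℤ._≤ ℤ.0ℤ) (sym (ℤ.*-identityʳ n)) n≤0)

evalℚ-embed : ∀ f p → evalℚ f (embed p) ≡ fromℤ (evalℤ f p)
evalℚ-embed (a , b , c) (x , y) = begin
  fromℤ a * fromℤ x + fromℤ b * fromℤ y + fromℤ c   ≡⟨ cong₂ (λ u v → u + v + fromℤ c) (fromℤ-* a x) (fromℤ-* b y) ⟨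
  fromℤ (a ℤ.* x) + fromℤ (b ℤ.* y) + fromℤ c       ≡⟨ cong (_+ fromℤ c) (fromℤ-+ (a ℤ.* x) (b ℤ.* y)) ⟨
  fromℤ (a ℤ.* x ℤ.+ b ℤ.* y) + fromℤ c             ≡⟨ fromℤ-+ (a ℤ.* x ℤ.+ b ℤ.* y) c ⟨
  fromℤ (a ℤ.* x ℤ.+ b ℤ.* y ℤ.+ c)                 ∎
  where open ≡-Reasoning

interpolate : ℚ → ℚ → ℚ → ℚ
interpolate t x y = x + t * (y - x)

evalℚ-onSegment : ∀ f {a b p} → OnSegment a b p →
                  ∃[ t ] (0ℚ ≤ t × t ≤ 1ℚ × evalℚ f p ≡ interpolate t (evalℚ f a) (evalℚ f b))
evalℚ-onSegment (α , β , γ) {a₁ , a₂} {b₁ , b₂} (t , 0≤t , t≤1 , refl , refl) =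
  t , 0≤t , t≤1 , affine (fromℤ α) (fromℤ β) (fromℤ γ) a₁ a₂ b₁ b₂ t
  where
  open +-*-Solver
  affine : ∀ α β γ a₁ a₂ b₁ b₂ t →
           α * (a₁ + t * (b₁ - a₁)) + β * (a₂ + t * (b₂ - a₂)) + γ ≡
           (α * a₁ + β * a₂ + γ) + t * ((α * b₁ + β * b₂ + γ) - (α * a₁ + β * a₂ + γ))
  affine = solve 8 (λ α β γ a₁ a₂ b₁ b₂ t →
           α :* (a₁ :+ t :* (b₁ :- a₁)) :+ β :* (a₂ :+ t :* (b₂ :- a₂)) :+ γ :=
           (α :* a₁ :+ β :* a₂ :+ γ) :+ t :* ((α :* b₁ :+ β :* b₂ :+ γ) :- (α :* a₁ :+ β :* a₂ :+ γ))) refl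

interpolate-flip : ∀ t x y → interpolate t x y ≡ interpolate (1ℚ - t) y x
interpolate-flip = solve 3 (λ t x y → x :+ t :* (y :- x) := y :+ (con 1ℚ :- t) :* (x :- y)) refl
  where open +-*-Solver

interpolate-1 : ∀ x y → interpolate 1ℚ x y ≡ y
interpolate-1 = solve 2 (λ x y → x :+ con 1ℚ :* (y :- x) := y) refl
  where open +-*-Solver

interpolate-0 : ∀ x y → interpolate 0ℚ x y ≡ x
interpolate-0 = solve 2 (λ x y → x :+ con 0ℚ :* (y :- x) := x) refl
  where open +-*-Solver

p≤q⇒0≤q-p : ∀ {p q} → p ≤ q → 0ℚ ≤ q - p
p≤q⇒0≤q-p {p} {q} p≤q = subst (_≤ q - p) (+-inverseʳ p) (+-monoˡ-≤ (- p) p≤q)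

1-t-bounds : ∀ {t} → 0ℚ ≤ t → t ≤ 1ℚ → 0ℚ ≤ 1ℚ - t × 1ℚ - t ≤ 1ℚ
1-t-bounds {t} 0≤t t≤1 = p≤q⇒0≤q-p t≤1 , subst (1ℚ - t ≤_) (+-identityʳ 1ℚ) (+-monoʳ-≤ 1ℚ (neg-antimono-≤ 0≤t))

interpolate-between : ∀ {t x y} → 0ℚ ≤ t → t ≤ 1ℚ → x ≤ y → x ≤ interpolate t x y × interpolate t x y ≤ y
interpolate-between {t} {x} {y} 0≤t t≤1 x≤y = lower , upper
  where
  instance
    _ = nonNegative (p≤q⇒0≤q-p x≤y)
  lower : x ≤ x + t * (y - x)
  lower = subst (_≤ x + t * (y - x)) (+-identityʳ x)
            (+-monoʳ-≤ x (subst (_≤ t * (y - x)) (*-zeroˡ (y - x)) (*-monoʳ-≤-nonNeg (y - x) 0≤t)))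
  upper : x + t * (y - x) ≤ y
  upper = subst (x + t * (y - x) ≤_) (interpolate-1 x y)
            (+-monoʳ-≤ x (*-monoʳ-≤-nonNeg (y - x) t≤1))

interpolate-≥-endpoint : ∀ {t} x y → 0ℚ ≤ t → t ≤ 1ℚ → x ≤ interpolate t x y ⊎ y ≤ interpolate t x y
interpolate-≥-endpoint {t} x y 0≤t t≤1 with ≤-total x y | 1-t-bounds 0≤t t≤1
... | inj₁ x≤y | _ = inj₁ (proj₁ (interpolate-between 0≤t t≤1 x≤y))
... | inj₂ y≤x | 0≤1-t , 1-t≤1 =
  inj₂ (subst (y ≤_) (sym (interpolate-flip t x y)) (proj₁ (interpolate-between 0≤1-t 1-t≤1 y≤x)))

interpolate-≤-endpoint : ∀ {t} x y → 0ℚ ≤ t → t ≤ 1ℚ → interpolate t x y ≤ x ⊎ interpolate t x y ≤ y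
interpolate-≤-endpoint {t} x y 0≤t t≤1 with ≤-total x y | 1-t-bounds 0≤t t≤1
... | inj₁ x≤y | _ = inj₂ (proj₂ (interpolate-between 0≤t t≤1 x≤y))
... | inj₂ y≤x | 0≤1-t , 1-t≤1 =
  inj₁ (subst (_≤ x) (sym (interpolate-flip t x y)) (proj₂ (interpolate-between 0≤1-t 1-t≤1 y≤x)))

evalℚ-pos-onSegment : ∀ f {a b p} → 0ℚ < evalℚ f a → 0ℚ < evalℚ f b → OnSegment a b p → 0ℚ < evalℚ f p
evalℚ-pos-onSegment f {a} {b} 0<fa 0<fb on with evalℚ-onSegment f {a} {b} on
... | t , 0≤t , t≤1 , fp≡ = subst (0ℚ <_) (sym fp≡)
  ([ <-≤-trans 0<fa , <-≤-trans 0<fb ]′ (interpolate-≥-endpoint _ _ 0≤t t≤1))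

evalℚ-nonPos-onSegment : ∀ f {a b p} → evalℚ f a ≤ 0ℚ → evalℚ f b ≤ 0ℚ → OnSegment a b p → evalℚ f p ≤ 0ℚ
evalℚ-nonPos-onSegment f {a} {b} fa≤0 fb≤0 on with evalℚ-onSegment f {a} {b} on
... | t , 0≤t , t≤1 , fp≡ = subst (_≤ 0ℚ) (sym fp≡)
  ([ (λ le → ≤-trans le fa≤0) , (λ le → ≤-trans le fb≤0) ]′ (interpolate-≤-endpoint _ _ 0≤t t≤1))

Segment : Set
Segment = IntPoint × IntPoint

OnSegmentℤ : Segment → Point → Set
OnSegmentℤ (a , b) = OnSegment (embed a) (embed b)

Separates : Affine → Segment → Segment → Set
Separates f (a , b) (c , d) =
  ℤ.0ℤ ℤ.< evalℤ f a × ℤ.0ℤ ℤ.< evalℤ f b × evalℤ f c ℤ.≤ ℤ.0ℤ × evalℤ f d ℤ.≤ ℤ.0ℤ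

separates⇒disjoint : ∀ f {s s′ p} → Separates f s s′ → OnSegmentℤ s p → OnSegmentℤ s′ p → ⊥
separates⇒disjoint f {a , b} {c , d} (0<fa , 0<fb , fc≤0 , fd≤0) on on′ =
  <-irrefl refl (<-≤-trans (evalℚ-pos-onSegment f {embed a} {embed b} (pos 0<fa) (pos 0<fb) on)
                           (evalℚ-nonPos-onSegment f {embed c} {embed d} (nonPos fc≤0) (nonPos fd≤0) on′))
  where
  pos : ∀ {q} → ℤ.0ℤ ℤ.< evalℤ f q → 0ℚ < evalℚ f (embed q)
  pos {q} 0<fq = subst (0ℚ <_) (sym (evalℚ-embed f q)) (fromℤ-pos 0<fq)
  nonPos : ∀ {q} → evalℤ f q ℤ.≤ ℤ.0ℤ → evalℚ f (embed q) ≤ 0ℚ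
  nonPos {q} fq≤0 = subst (_≤ 0ℚ) (sym (evalℚ-embed f q)) (fromℤ-nonPos fq≤0)

lineThrough : Segment → Affine
lineThrough ((a₁ , a₂) , (b₁ , b₂)) = a₂ ℤ.- b₂ , b₁ ℤ.- a₁ , a₁ ℤ.* b₂ ℤ.- a₂ ℤ.* b₁

negate : Affine → Affine
negate (a , b , c) = ℤ.- a , ℤ.- b , ℤ.- c

-- Only lines through one of the two segments are tried: enough for the drawing below,
-- though not for every pair of disjoint segments (e.g. collinear ones).
Separated : Segment → Segment → Set
Separated s s′ = Separates (lineThrough s′) s s′ ⊎ Separates (negate (lineThrough s′)) s s′
               ⊎ Separates (lineThrough s) s′ s ⊎ Separates (negate (lineThrough s)) s′ s

separates? : ∀ f s s′ → Dec (Separates f s s′)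
separates? f (a , b) (c , d) =
  ℤ.0ℤ ℤ.<? evalℤ f a ×-dec ℤ.0ℤ ℤ.<? evalℤ f b ×-dec evalℤ f c ℤ.≤? ℤ.0ℤ ×-dec evalℤ f d ℤ.≤? ℤ.0ℤ

separated? : ∀ s s′ → Dec (Separated s s′)
separated? s s′ = separates? (lineThrough s′) s s′ ⊎-dec separates? (negate (lineThrough s′)) s s′
           ⊎-dec separates? (lineThrough s) s′ s ⊎-dec separates? (negate (lineThrough s)) s′ s

separated⇒disjoint : ∀ {s s′ p} → Separated s s′ → OnSegmentℤ s p → OnSegmentℤ s′ p → ⊥
separated⇒disjoint {s} {s′} (inj₁ sep)               on on′ = separates⇒disjoint (lineThrough s′) sep on on′
separated⇒disjoint {s} {s′} (inj₂ (inj₁ sep))        on on′ = separates⇒disjoint (negate (lineThrough s′)) sep on on′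
separated⇒disjoint {s} {s′} (inj₂ (inj₂ (inj₁ sep))) on on′ = separates⇒disjoint (lineThrough s) sep on′ on
separated⇒disjoint {s} {s′} (inj₂ (inj₂ (inj₂ sep))) on on′ = separates⇒disjoint (negate (lineThrough s)) sep on′ on

onSegment-sym : ∀ {a b p} → OnSegment a b p → OnSegment b a p
onSegment-sym {a₁ , a₂} {b₁ , b₂} (t , 0≤t , t≤1 , refl , refl) =
  1ℚ - t , 0≤1-t , 1-t≤1 , interpolate-flip t a₁ b₁ , interpolate-flip t a₂ b₂
  where
  0≤1-t = proj₁ (1-t-bounds 0≤t t≤1)
  1-t≤1 = proj₂ (1-t-bounds 0≤t t≤1)

onSegment-refl : ∀ a → OnSegment a a a
onSegment-refl (a₁ , a₂) = 0ℚ , ≤-refl , *≤* (ℤ.+≤+ ℕ.z≤n) , sym (interpolate-0 a₁ a₁) , sym (interpolate-0 a₂ a₂)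

-- Graphs given by edge lists

allPairs-∈ : ∀ {A : Set} {R : A → A → Set} {xs x y} → AllPairs R xs → x ∈ xs → y ∈ xs →
             x ≡ y ⊎ R x y ⊎ R y x
allPairs-∈ (_ ∷ _)   (here refl) (here refl) = inj₁ refl
allPairs-∈ (Rx ∷ _)  (here refl) (there y∈)  = inj₂ (inj₁ (All.lookup Rx y∈))
allPairs-∈ (Rx ∷ _)  (there x∈)  (here refl) = inj₂ (inj₂ (All.lookup Rx x∈))
allPairs-∈ (_ ∷ Rxs) (there x∈)  (there y∈)  = allPairs-∈ Rxs x∈ y∈

_∈ₑ_ : ℕ → ℕ × ℕ → Set
w ∈ₑ (a , b) = w ≡ a ⊎ w ≡ b

_∈ₑ?_ : ∀ w e → Dec (w ∈ₑ e)
w ∈ₑ? (a , b) = w ℕ.≟ a ⊎-dec w ℕ.≟ b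

Disjoint : ℕ × ℕ → ℕ × ℕ → Set
Disjoint e e′ = ∀ {w} → w ∈ₑ e → ¬ w ∈ₑ e′

SharesEndpoint : ℕ × ℕ → ℕ × ℕ → Set
SharesEndpoint (a , b) e = a ∈ₑ e ⊎ b ∈ₑ e

sharedEndpoint : ∀ {e e′} → SharesEndpoint e e′ → ∃[ w ] (w ∈ₑ e × w ∈ₑ e′)
sharedEndpoint (inj₁ a∈) = _ , inj₁ refl , a∈
sharedEndpoint (inj₂ b∈) = _ , inj₂ refl , b∈

Joins : ℕ × ℕ → ℕ → ℕ → Set
Joins e u v = e ≡ (u , v) ⊎ e ≡ (v , u)

joins-left : ∀ {e u v} → Joins e u v → u ∈ₑ e
joins-left (inj₁ refl) = inj₁ refl
joins-left (inj₂ refl) = inj₂ refl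

joins-∈ₑ : ∀ {e u v w} → Joins e u v → w ∈ₑ e → w ∈ₑ (u , v)
joins-∈ₑ (inj₁ refl) w∈ = w∈
joins-∈ₑ (inj₂ refl) w∈ = Sum.swap w∈

record Homomorphism {n m} (G : Graph n) (H : Graph m) : Set where
  field
    vertexMap     : Fin n → Fin m
    preserves-adj : ∀ u v → Adj G u v → Adj H (vertexMap u) (vertexMap v)

homomorphism-triangleFree : ∀ {n m} {G : Graph n} {H : Graph m} → Homomorphism G H → TriangleFree H → TriangleFree G
homomorphism-triangleFree hom H-free u v w uv vw uw =
  H-free (f u) (f v) (f w) (preserves-adj u v uv) (preserves-adj v w vw) (preserves-adj u w uw)
  where open Homomorphism hom renaming (vertexMap to f)

module EdgeList (edges : List (ℕ × ℕ)) where

  joinsᵇ : ℕ → ℕ → ℕ × ℕ → Bool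
  joinsᵇ u v (a , b) = ((a ℕ.≡ᵇ u) ∧ (b ℕ.≡ᵇ v)) ∨ ((a ℕ.≡ᵇ v) ∧ (b ℕ.≡ᵇ u))

  joinsᵇ⇒joins : ∀ {u v} e → T (joinsᵇ u v e) → Joins e u v
  joinsᵇ⇒joins {u} {v} (a , b) t with Equivalence.to T-∨ t
  ... | inj₁ t′ = inj₁ (cong₂ _,_ (ℕ.≡ᵇ⇒≡ a u (proj₁ (Equivalence.to T-∧ t′))) (ℕ.≡ᵇ⇒≡ b v (proj₂ (Equivalence.to T-∧ t′))))
  ... | inj₂ t′ = inj₂ (cong₂ _,_ (ℕ.≡ᵇ⇒≡ a v (proj₁ (Equivalence.to T-∧ t′))) (ℕ.≡ᵇ⇒≡ b u (proj₂ (Equivalence.to T-∧ t′))))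

  isEdgeᵇ : ℕ → ℕ → Bool
  isEdgeᵇ u v = any (joinsᵇ u v) edges

  joinsᵇ-sym : ∀ u v e → joinsᵇ u v e ≡ joinsᵇ v u e
  joinsᵇ-sym u v (a , b) = ∨-comm ((a ℕ.≡ᵇ u) ∧ (b ℕ.≡ᵇ v)) ((a ℕ.≡ᵇ v) ∧ (b ℕ.≡ᵇ u))

  isEdgeᵇ-sym : ∀ u v → isEdgeᵇ u v ≡ isEdgeᵇ v u
  isEdgeᵇ-sym u v = cong or (map-cong (joinsᵇ-sym u v) edges)

  listedEdge : ∀ {u v} → T (isEdgeᵇ u v) → ∃[ e ] (e ∈ edges × Joins e u v)
  listedEdge {u} {v} t with find (any⁻ (joinsᵇ u v) edges t)
  ... | e , e∈ , joins = e , e∈ , joinsᵇ⇒joins e joins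

  Loopless : Set
  Loopless = All (λ e → proj₁ e ≢ proj₂ e) edges

  isEdgeᵇ-irrefl : Loopless → ∀ w → isEdgeᵇ w w ≡ false
  isEdgeᵇ-irrefl loopless w = dec-false (T? (isEdgeᵇ w w)) loop
    where
    loop : ¬ T (isEdgeᵇ w w)
    loop t with listedEdge t
    ... | _ , ww∈ , inj₁ refl = All.lookup loopless ww∈ refl
    ... | _ , ww∈ , inj₂ refl = All.lookup loopless ww∈ refl

  module _ (n : ℕ) (loopless : Loopless) where

    graph : Graph n
    graph = record
      { adj        = λ u v → isEdgeᵇ (toℕ u) (toℕ v)
      ; adj-sym    = λ u v → isEdgeᵇ-sym (toℕ u) (toℕ v)
      ; adj-irrefl = λ v → isEdgeᵇ-irrefl loopless (toℕ v)
      }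

    adj⇒listedEdge : ∀ {u v} → Adj graph u v → ∃[ e ] (e ∈ edges × Joins e (toℕ u) (toℕ v))
    adj⇒listedEdge uv = listedEdge (Equivalence.from T-≡ uv)

    graph-homomorphism : ∀ {m} (H : Graph m) (f : ℕ → Fin m) →
                         All (λ e → Adj H (f (proj₁ e)) (f (proj₂ e))) edges → Homomorphism graph H
    graph-homomorphism H f hom = record { vertexMap = f ∘ toℕ ; preserves-adj = preserves }
      where
      preserves : ∀ u v → Adj graph u v → Adj H (f (toℕ u)) (f (toℕ v))
      preserves u v uv with adj⇒listedEdge uv
      ... | _ , e∈ , inj₁ refl = All.lookup hom e∈
      ... | _ , e∈ , inj₂ refl = trans (adj-sym H _ _) (All.lookup hom e∈)

  module Drawing (position : ℕ → IntPoint) where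

    segment : ℕ × ℕ → Segment
    segment (u , v) = position u , position v

    joins-onSegment : ∀ {e u v p} → Joins e u v → OnSegmentℤ (segment (u , v)) p → OnSegmentℤ (segment e) p
    joins-onSegment           (inj₁ refl) on = on
    joins-onSegment {u = u} {v} (inj₂ refl) on = onSegment-sym {embed (position u)} {embed (position v)} on

    InjectiveBelow : ℕ → Set
    InjectiveBelow n = ∀ {k} → k ℕ.< n → ∀ {l} → l ℕ.< n → position k ≡ position l → k ≡ l

    VerticesOffEdges : ℕ → Set
    VerticesOffEdges n = All (λ e → ∀ {w} → w ℕ.< n → w ∈ₑ e ⊎ Separated (segment e) (position w , position w)) edges

    Compatible : ℕ × ℕ → ℕ × ℕ → Set
    Compatible e e′ = SharesEndpoint e e′ ⊎ Separated (segment e) (segment e′)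

    listed-vertex-off : ∀ {n} → VerticesOffEdges n → ∀ {e u v w} → e ∈ edges → Joins e u v → w ℕ.< n →
                        ¬ w ∈ₑ (u , v) → ¬ OnSegmentℤ (segment (u , v)) (embed (position w))
    listed-vertex-off off e∈ e⋈ w<n w∉ on with All.lookup off e∈ w<n
    ... | inj₁ w∈e = w∉ (joins-∈ₑ e⋈ w∈e)
    ... | inj₂ sep = separated⇒disjoint sep (joins-onSegment e⋈ on) (onSegment-refl _)

    compatible-disjoint : ∀ {e e′ u v x y p} → Joins e u v → Joins e′ x y → Disjoint (u , v) (x , y) →
                          Compatible e e′ → OnSegmentℤ (segment (u , v)) p → ¬ OnSegmentℤ (segment (x , y)) p
    compatible-disjoint e⋈ e′⋈ disjoint (inj₁ shared) _ _ with sharedEndpoint shared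
    ... | w , w∈e , w∈e′ = disjoint (joins-∈ₑ e⋈ w∈e) (joins-∈ₑ e′⋈ w∈e′)
    compatible-disjoint e⋈ e′⋈ disjoint (inj₂ sep) on on′ =
      separated⇒disjoint sep (joins-onSegment e⋈ on) (joins-onSegment e′⋈ on′)

    listed-disjoint : AllPairs Compatible edges → ∀ {e e′ u v x y p} → e ∈ edges → Joins e u v → e′ ∈ edges → Joins e′ x y →
                      Disjoint (u , v) (x , y) → OnSegmentℤ (segment (u , v)) p → ¬ OnSegmentℤ (segment (x , y)) p
    listed-disjoint compatible e∈ e⋈ e′∈ e′⋈ disjoint on on′ with allPairs-∈ compatible e∈ e′∈
    ... | inj₁ refl      = disjoint (joins-∈ₑ e⋈ (joins-left e′⋈)) (inj₁ refl)
    ... | inj₂ (inj₁ ok) = compatible-disjoint e⋈ e′⋈ disjoint ok on on′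
    ... | inj₂ (inj₂ ok) = compatible-disjoint e′⋈ e⋈ (flip disjoint) ok on′ on

    graph-planar : ∀ {n} loopless → InjectiveBelow n → VerticesOffEdges n → AllPairs Compatible edges →
                   Planar (graph n loopless)
    graph-planar {n} loopless injective off compatible = record
      { pos        = λ u → embed (position (toℕ u))
      ; pos-inj    = λ u v eq → toℕ-injective (injective (toℕ<n u) (toℕ<n v) (embed-injective eq))
      ; vertex-off = vertex-off
      ; no-cross   = no-cross
      }
      where
      vertex-off : ∀ u v w → Adj (graph n loopless) u v → w ≢ u → w ≢ v →
                   ¬ OnSegmentℤ (segment (toℕ u , toℕ v)) (embed (position (toℕ w)))
      vertex-off u v w uv w≢u w≢v with adj⇒listedEdge n loopless uv
      ... | _ , e∈ , e⋈ = listed-vertex-off off e∈ e⋈ (toℕ<n w) [ w≢u ∘ toℕ-injective , w≢v ∘ toℕ-injective ]′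

      no-cross : ∀ u v x y → Adj (graph n loopless) u v → Adj (graph n loopless) x y →
                 x ≢ u → x ≢ v → y ≢ u → y ≢ v →
                 ¬ (∃[ p ] (OnSegmentℤ (segment (toℕ u , toℕ v)) p × OnSegmentℤ (segment (toℕ x , toℕ y)) p))
      no-cross u v x y uv xy x≢u x≢v y≢u y≢v (p , on , on′)
        with adj⇒listedEdge n loopless uv | adj⇒listedEdge n loopless xy
      ... | _ , e∈ , e⋈ | _ , e′∈ , e′⋈ = listed-disjoint compatible e∈ e⋈ e′∈ e′⋈ disjoint on on′
        where
        disjoint : Disjoint (toℕ u , toℕ v) (toℕ x , toℕ y)
        disjoint (inj₁ refl) (inj₁ eq) = x≢u (toℕ-injective (sym eq))
        disjoint (inj₂ refl) (inj₁ eq) = x≢v (toℕ-injective (sym eq))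
        disjoint (inj₁ refl) (inj₂ eq) = y≢u (toℕ-injective (sym eq))
        disjoint (inj₂ refl) (inj₂ eq) = y≢v (toℕ-injective (sym eq))

-- List colouring by search

T-not⇒¬T : ∀ {b} → T (not b) → ¬ T b
T-not⇒¬T {false} _ ()

module ListColouringSearch {n} (G : Graph n) (L : Fin n → List ℤ) where

  Assignment : Set
  Assignment = List (Fin n × ℤ)

  Agrees : (Fin n → ℤ) → Assignment → Set
  Agrees c = All (λ vk → c (proj₁ vk) ≡ proj₂ vk)

  fits : Fin n → ℤ → Assignment → Bool
  fits v k = all (λ uk → not (does (k ℤ.≟ proj₂ uk) ∧ adj G (proj₁ uk) v))

  extendable : Assignment → List (Fin n) → Bool
  extendable σ []       = true
  extendable σ (v ∷ vs) = any (λ k → fits v k σ ∧ extendable ((v , k) ∷ σ) vs) (L v)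

  -- Below the roots the blocks are searched separately; a colouring restricts to each of them.
  refutes : List (List (Fin n)) → List (Fin n) → Assignment → Bool
  refutes blocks []       σ = any (λ block → not (extendable σ block)) blocks
  refutes blocks (v ∷ vs) σ = all (λ k → not (fits v k σ) ∨ refutes blocks vs ((v , k) ∷ σ)) (L v)

  module _ {c : Fin n → ℤ} (proper : ProperColouring G c) (c∈L : ∀ v → c v ∈ L v) where

    fits-colour : ∀ v {σ} → Agrees c σ → T (fits v (c v) σ)
    fits-colour v agrees = all⁻ _ (All.map no-conflict agrees)
      where
      no-conflict : ∀ {uk : Fin n × ℤ} → c (proj₁ uk) ≡ proj₂ uk →
                    T (not (does (c v ℤ.≟ proj₂ uk) ∧ adj G (proj₁ uk) v))
      no-conflict {u , k} cu≡k with c v ℤ.≟ k | adj G u v in uv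
      ... | no _     | _     = _
      ... | yes _    | false = _
      ... | yes cv≡k | true  = proper u v uv (trans cu≡k (sym cv≡k))

    extendable-colour : ∀ {σ} → Agrees c σ → ∀ vs → T (extendable σ vs)
    extendable-colour agrees []       = _
    extendable-colour {σ} agrees (v ∷ vs) = any⁺ _ (Any.map extend (c∈L v))
      where
      extend : ∀ {k} → c v ≡ k → T (fits v k σ ∧ extendable ((v , k) ∷ σ) vs)
      extend refl = Equivalence.from T-∧ (fits-colour v agrees , extendable-colour (refl ∷ agrees) vs)

    refutes-colour : ∀ blocks vs {σ} → Agrees c σ → ¬ T (refutes blocks vs σ)
    refutes-colour blocks [] agrees r with Any.satisfied (any⁻ _ blocks r)
    ... | block , stuck = T-not⇒¬T stuck (extendable-colour agrees block)
    refutes-colour blocks (v ∷ vs) agrees r =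
      [ (λ misfit → T-not⇒¬T misfit (fits-colour v agrees))
      , refutes-colour blocks vs (refl ∷ agrees)
      ]′ (Equivalence.to T-∨ (All.lookup (all⁺ _ (L v) r) (c∈L v)))

  no-list-colouring : ∀ blocks roots → T (refutes blocks roots []) →
                      ¬ (∃[ c ] (ProperColouring G c × (∀ v → c v ∈ L v)))
  no-list-colouring blocks roots r (c , proper , c∈L) = refutes-colour proper c∈L blocks roots [] r

-- Vertex 0 is x and vertex 1 is y; gadget g < 9, the one for x coloured ⌊g / 3⌋ and y coloured
-- 3 + g mod 3, occupies vertices 2 + 14 g, …, 15 + 14 g; vertices 128, …, 163 are isolated.
module GraphData where
  open import Agda.Builtin.FromNat using (Number; fromNat)
  open import Agda.Builtin.FromNeg using (Negative; fromNeg)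
  open import Data.Unit using (tt)
  import Data.Integer.Literals
  import Data.Nat.Literals

  instance
    ℕ-number : Number ℕ
    ℕ-number = Data.Nat.Literals.number
    ℤ-number : Number ℤ
    ℤ-number = Data.Integer.Literals.number
    ℤ-negative : Negative ℤ
    ℤ-negative = Data.Integer.Literals.negative

  edges : List (ℕ × ℕ)
  edges =
    (0 , 2) ∷ (2 , 1) ∷ (0 , 3) ∷ (3 , 1) ∷ (0 , 4) ∷ (4 , 5) ∷ (5 , 1) ∷ (0 , 6) ∷ (6 , 7) ∷
    (0 , 11) ∷ (11 , 12) ∷ (2 , 7) ∷ (7 , 8) ∷ (3 , 12) ∷ (12 , 13) ∷ (1 , 8) ∷ (8 , 9) ∷ (1 , 13) ∷
    (13 , 14) ∷ (5 , 9) ∷ (9 , 10) ∷ (5 , 14) ∷ (14 , 15) ∷ (4 , 10) ∷ (10 , 6) ∷ (4 , 15) ∷ (15 , 11) ∷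
    (0 , 16) ∷ (16 , 1) ∷ (0 , 17) ∷ (17 , 1) ∷ (0 , 18) ∷ (18 , 19) ∷ (19 , 1) ∷ (0 , 20) ∷ (20 , 21) ∷
    (0 , 25) ∷ (25 , 26) ∷ (16 , 21) ∷ (21 , 22) ∷ (17 , 26) ∷ (26 , 27) ∷ (1 , 22) ∷ (22 , 23) ∷ (1 , 27) ∷
    (27 , 28) ∷ (19 , 23) ∷ (23 , 24) ∷ (19 , 28) ∷ (28 , 29) ∷ (18 , 24) ∷ (24 , 20) ∷ (18 , 29) ∷ (29 , 25) ∷
    (0 , 30) ∷ (30 , 1) ∷ (0 , 31) ∷ (31 , 1) ∷ (0 , 32) ∷ (32 , 33) ∷ (33 , 1) ∷ (0 , 34) ∷ (34 , 35) ∷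
    (0 , 39) ∷ (39 , 40) ∷ (30 , 35) ∷ (35 , 36) ∷ (31 , 40) ∷ (40 , 41) ∷ (1 , 36) ∷ (36 , 37) ∷ (1 , 41) ∷
    (41 , 42) ∷ (33 , 37) ∷ (37 , 38) ∷ (33 , 42) ∷ (42 , 43) ∷ (32 , 38) ∷ (38 , 34) ∷ (32 , 43) ∷ (43 , 39) ∷
    (0 , 44) ∷ (44 , 1) ∷ (0 , 45) ∷ (45 , 1) ∷ (0 , 46) ∷ (46 , 47) ∷ (47 , 1) ∷ (0 , 48) ∷ (48 , 49) ∷
    (0 , 53) ∷ (53 , 54) ∷ (44 , 49) ∷ (49 , 50) ∷ (45 , 54) ∷ (54 , 55) ∷ (1 , 50) ∷ (50 , 51) ∷ (1 , 55) ∷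
    (55 , 56) ∷ (47 , 51) ∷ (51 , 52) ∷ (47 , 56) ∷ (56 , 57) ∷ (46 , 52) ∷ (52 , 48) ∷ (46 , 57) ∷ (57 , 53) ∷
    (0 , 58) ∷ (58 , 1) ∷ (0 , 59) ∷ (59 , 1) ∷ (0 , 60) ∷ (60 , 61) ∷ (61 , 1) ∷ (0 , 62) ∷ (62 , 63) ∷
    (0 , 67) ∷ (67 , 68) ∷ (58 , 63) ∷ (63 , 64) ∷ (59 , 68) ∷ (68 , 69) ∷ (1 , 64) ∷ (64 , 65) ∷ (1 , 69) ∷
    (69 , 70) ∷ (61 , 65) ∷ (65 , 66) ∷ (61 , 70) ∷ (70 , 71) ∷ (60 , 66) ∷ (66 , 62) ∷ (60 , 71) ∷ (71 , 67) ∷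
    (0 , 72) ∷ (72 , 1) ∷ (0 , 73) ∷ (73 , 1) ∷ (0 , 74) ∷ (74 , 75) ∷ (75 , 1) ∷ (0 , 76) ∷ (76 , 77) ∷
    (0 , 81) ∷ (81 , 82) ∷ (72 , 77) ∷ (77 , 78) ∷ (73 , 82) ∷ (82 , 83) ∷ (1 , 78) ∷ (78 , 79) ∷ (1 , 83) ∷
    (83 , 84) ∷ (75 , 79) ∷ (79 , 80) ∷ (75 , 84) ∷ (84 , 85) ∷ (74 , 80) ∷ (80 , 76) ∷ (74 , 85) ∷ (85 , 81) ∷
    (0 , 86) ∷ (86 , 1) ∷ (0 , 87) ∷ (87 , 1) ∷ (0 , 88) ∷ (88 , 89) ∷ (89 , 1) ∷ (0 , 90) ∷ (90 , 91) ∷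
    (0 , 95) ∷ (95 , 96) ∷ (86 , 91) ∷ (91 , 92) ∷ (87 , 96) ∷ (96 , 97) ∷ (1 , 92) ∷ (92 , 93) ∷ (1 , 97) ∷
    (97 , 98) ∷ (89 , 93) ∷ (93 , 94) ∷ (89 , 98) ∷ (98 , 99) ∷ (88 , 94) ∷ (94 , 90) ∷ (88 , 99) ∷ (99 , 95) ∷
    (0 , 100) ∷ (100 , 1) ∷ (0 , 101) ∷ (101 , 1) ∷ (0 , 102) ∷ (102 , 103) ∷ (103 , 1) ∷ (0 , 104) ∷ (104 , 105) ∷
    (0 , 109) ∷ (109 , 110) ∷ (100 , 105) ∷ (105 , 106) ∷ (101 , 110) ∷ (110 , 111) ∷ (1 , 106) ∷ (106 , 107) ∷ (1 , 111) ∷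
    (111 , 112) ∷ (103 , 107) ∷ (107 , 108) ∷ (103 , 112) ∷ (112 , 113) ∷ (102 , 108) ∷ (108 , 104) ∷ (102 , 113) ∷ (113 , 109) ∷
    (0 , 114) ∷ (114 , 1) ∷ (0 , 115) ∷ (115 , 1) ∷ (0 , 116) ∷ (116 , 117) ∷ (117 , 1) ∷ (0 , 118) ∷ (118 , 119) ∷
    (0 , 123) ∷ (123 , 124) ∷ (114 , 119) ∷ (119 , 120) ∷ (115 , 124) ∷ (124 , 125) ∷ (1 , 120) ∷ (120 , 121) ∷ (1 , 125) ∷
    (125 , 126) ∷ (117 , 121) ∷ (121 , 122) ∷ (117 , 126) ∷ (126 , 127) ∷ (116 , 122) ∷ (122 , 118) ∷ (116 , 127) ∷ (127 , 123) ∷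
    []

  gadgetPositions : List IntPoint
  gadgetPositions =
    (0 , 0) ∷ (4000 , 0) ∷
    (2000 , 1600) ∷ (2060 , 800) ∷ (1600 , 1040) ∷ (2420 , 1060) ∷ (1000 , 700) ∷ (2020 , 1500) ∷ (3000 , 700) ∷
    (2220 , 1220) ∷ (1780 , 1240) ∷ (1020 , 460) ∷ (1960 , 860) ∷ (2980 , 480) ∷ (2200 , 980) ∷ (1820 , 960) ∷
    (2080 , 4800) ∷ (2100 , 2400) ∷ (1652 , 3120) ∷ (2473 , 3180) ∷ (1035 , 2100) ∷ (2095 , 4500) ∷ (3035 , 2100) ∷
    (2281 , 3660) ∷ (1842 , 3720) ∷ (1043 , 1380) ∷ (2003 , 2580) ∷ (3004 , 1440) ∷ (2249 , 2940) ∷ (1868 , 2880) ∷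
    (2160 , 14400) ∷ (2140 , 7200) ∷ (1704 , 9360) ∷ (2526 , 9540) ∷ (1070 , 6300) ∷ (2170 , 13500) ∷ (3070 , 6300) ∷
    (2342 , 10980) ∷ (1904 , 11160) ∷ (1066 , 4140) ∷ (2046 , 7740) ∷ (3028 , 4320) ∷ (2298 , 8820) ∷ (1916 , 8640) ∷
    (2240 , 43200) ∷ (2180 , 21600) ∷ (1756 , 28080) ∷ (2579 , 28620) ∷ (1105 , 18900) ∷ (2245 , 40500) ∷ (3105 , 18900) ∷
    (2403 , 32940) ∷ (1966 , 33480) ∷ (1089 , 12420) ∷ (2089 , 23220) ∷ (3052 , 12960) ∷ (2347 , 26460) ∷ (1964 , 25920) ∷
    (2320 , 129600) ∷ (2220 , 64800) ∷ (1808 , 84240) ∷ (2632 , 85860) ∷ (1140 , 56700) ∷ (2320 , 121500) ∷ (3140 , 56700) ∷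
    (2464 , 98820) ∷ (2028 , 100440) ∷ (1112 , 37260) ∷ (2132 , 69660) ∷ (3076 , 38880) ∷ (2396 , 79380) ∷ (2012 , 77760) ∷
    (1920 , -1600) ∷ (2020 , -800) ∷ (1548 , -1040) ∷ (2367 , -1060) ∷ (965 , -700) ∷ (1945 , -1500) ∷ (2965 , -700) ∷
    (2159 , -1220) ∷ (1718 , -1240) ∷ (997 , -460) ∷ (1917 , -860) ∷ (2956 , -480) ∷ (2151 , -980) ∷ (1772 , -960) ∷
    (1840 , -4800) ∷ (1980 , -2400) ∷ (1496 , -3120) ∷ (2314 , -3180) ∷ (930 , -2100) ∷ (1870 , -4500) ∷ (2930 , -2100) ∷
    (2098 , -3660) ∷ (1656 , -3720) ∷ (974 , -1380) ∷ (1874 , -2580) ∷ (2932 , -1440) ∷ (2102 , -2940) ∷ (1724 , -2880) ∷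
    (1760 , -14400) ∷ (1940 , -7200) ∷ (1444 , -9360) ∷ (2261 , -9540) ∷ (895 , -6300) ∷ (1795 , -13500) ∷ (2895 , -6300) ∷
    (2037 , -10980) ∷ (1594 , -11160) ∷ (951 , -4140) ∷ (1831 , -7740) ∷ (2908 , -4320) ∷ (2053 , -8820) ∷ (1676 , -8640) ∷
    (1680 , -43200) ∷ (1900 , -21600) ∷ (1392 , -28080) ∷ (2208 , -28620) ∷ (860 , -18900) ∷ (1720 , -40500) ∷ (2860 , -18900) ∷
    (1976 , -32940) ∷ (1532 , -33480) ∷ (928 , -12420) ∷ (1788 , -23220) ∷ (2884 , -12960) ∷ (2004 , -26460) ∷ (1628 , -25920) ∷
    []

  gadgetLists : List (ℤ × ℤ × ℤ)
  gadgetLists =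
    (0 , 1 , 2) ∷ (3 , 4 , 5) ∷
    (0 , 3 , 10) ∷ (0 , 3 , 11) ∷ (0 , 12 , 13) ∷ (3 , 12 , 13) ∷ (0 , 14 , 15) ∷ (10 , 14 , 15) ∷ (3 , 14 , 15) ∷
    (12 , 14 , 15) ∷ (13 , 14 , 15) ∷ (0 , 16 , 17) ∷ (11 , 16 , 17) ∷ (3 , 16 , 17) ∷ (13 , 16 , 17) ∷ (12 , 16 , 17) ∷
    (0 , 4 , 20) ∷ (0 , 4 , 21) ∷ (0 , 22 , 23) ∷ (4 , 22 , 23) ∷ (0 , 24 , 25) ∷ (20 , 24 , 25) ∷ (4 , 24 , 25) ∷
    (22 , 24 , 25) ∷ (23 , 24 , 25) ∷ (0 , 26 , 27) ∷ (21 , 26 , 27) ∷ (4 , 26 , 27) ∷ (23 , 26 , 27) ∷ (22 , 26 , 27) ∷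
    (0 , 5 , 30) ∷ (0 , 5 , 31) ∷ (0 , 32 , 33) ∷ (5 , 32 , 33) ∷ (0 , 34 , 35) ∷ (30 , 34 , 35) ∷ (5 , 34 , 35) ∷
    (32 , 34 , 35) ∷ (33 , 34 , 35) ∷ (0 , 36 , 37) ∷ (31 , 36 , 37) ∷ (5 , 36 , 37) ∷ (33 , 36 , 37) ∷ (32 , 36 , 37) ∷
    (1 , 3 , 40) ∷ (1 , 3 , 41) ∷ (1 , 42 , 43) ∷ (3 , 42 , 43) ∷ (1 , 44 , 45) ∷ (40 , 44 , 45) ∷ (3 , 44 , 45) ∷
    (42 , 44 , 45) ∷ (43 , 44 , 45) ∷ (1 , 46 , 47) ∷ (41 , 46 , 47) ∷ (3 , 46 , 47) ∷ (43 , 46 , 47) ∷ (42 , 46 , 47) ∷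
    (1 , 4 , 50) ∷ (1 , 4 , 51) ∷ (1 , 52 , 53) ∷ (4 , 52 , 53) ∷ (1 , 54 , 55) ∷ (50 , 54 , 55) ∷ (4 , 54 , 55) ∷
    (52 , 54 , 55) ∷ (53 , 54 , 55) ∷ (1 , 56 , 57) ∷ (51 , 56 , 57) ∷ (4 , 56 , 57) ∷ (53 , 56 , 57) ∷ (52 , 56 , 57) ∷
    (1 , 5 , 60) ∷ (1 , 5 , 61) ∷ (1 , 62 , 63) ∷ (5 , 62 , 63) ∷ (1 , 64 , 65) ∷ (60 , 64 , 65) ∷ (5 , 64 , 65) ∷
    (62 , 64 , 65) ∷ (63 , 64 , 65) ∷ (1 , 66 , 67) ∷ (61 , 66 , 67) ∷ (5 , 66 , 67) ∷ (63 , 66 , 67) ∷ (62 , 66 , 67) ∷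
    (2 , 3 , 70) ∷ (2 , 3 , 71) ∷ (2 , 72 , 73) ∷ (3 , 72 , 73) ∷ (2 , 74 , 75) ∷ (70 , 74 , 75) ∷ (3 , 74 , 75) ∷
    (72 , 74 , 75) ∷ (73 , 74 , 75) ∷ (2 , 76 , 77) ∷ (71 , 76 , 77) ∷ (3 , 76 , 77) ∷ (73 , 76 , 77) ∷ (72 , 76 , 77) ∷
    (2 , 4 , 80) ∷ (2 , 4 , 81) ∷ (2 , 82 , 83) ∷ (4 , 82 , 83) ∷ (2 , 84 , 85) ∷ (80 , 84 , 85) ∷ (4 , 84 , 85) ∷
    (82 , 84 , 85) ∷ (83 , 84 , 85) ∷ (2 , 86 , 87) ∷ (81 , 86 , 87) ∷ (4 , 86 , 87) ∷ (83 , 86 , 87) ∷ (82 , 86 , 87) ∷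
    (2 , 5 , 90) ∷ (2 , 5 , 91) ∷ (2 , 92 , 93) ∷ (5 , 92 , 93) ∷ (2 , 94 , 95) ∷ (90 , 94 , 95) ∷ (5 , 94 , 95) ∷
    (92 , 94 , 95) ∷ (93 , 94 , 95) ∷ (2 , 96 , 97) ∷ (91 , 96 , 97) ∷ (5 , 96 , 97) ∷ (93 , 96 , 97) ∷ (92 , 96 , 97) ∷
    []

open GraphData using (edges; gadgetPositions; gadgetLists)

positionOf : ℕ → IntPoint
positionOf k = fromMaybe (+ 0 , + 0) (head (drop k positions))
  where
  positions = gadgetPositions ++ applyUpTo (λ i → + (128 ℕ.+ i) , + 10000000) 36

colourList : Fin 164 → List ℤ
colourList v = triple (fromMaybe (+ 0 , + 1 , + 2) (head (drop (toℕ v) gadgetLists)))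
  where
  triple : ℤ × ℤ × ℤ → List ℤ
  triple (a , b , c) = a ∷ b ∷ c ∷ []

toC₅ : ℕ → Fin 5
toC₅ k = fromMaybe (# 0) (head (drop k (# 0 ∷ # 2 ∷ concat (replicate 9 gadgetPattern))))
  where
  gadgetPattern : List (Fin 5)
  gadgetPattern = # 1 ∷ # 1 ∷ # 4 ∷ # 3 ∷ # 1 ∷ # 2 ∷ # 3 ∷ # 4 ∷ # 0 ∷ # 1 ∷ # 2 ∷ # 3 ∷ # 4 ∷ # 0 ∷ []

open EdgeList

C₅ : Graph 5
C₅ = graph cycle 5 (toWitness {a? = All.all? (λ e → ¬? (proj₁ e ℕ.≟ proj₂ e)) cycle} _)
  where
  cycle = (0 , 1) ∷ (1 , 2) ∷ (2 , 3) ∷ (3 , 4) ∷ (4 , 0) ∷ []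

C₅-triangleFree : TriangleFree C₅
C₅-triangleFree = toWitness {a? = Fin.all? λ u → Fin.all? λ v → Fin.all? λ w →
  adj C₅ u v Bool.≟ true →-dec adj C₅ v w Bool.≟ true →-dec ¬? (adj C₅ u w Bool.≟ true)} _

open Drawing edges positionOf

loopless : Loopless edges
loopless = toWitness {a? = All.all? (λ e → ¬? (proj₁ e ℕ.≟ proj₂ e)) edges} _

G : Graph 164
G = graph edges 164 loopless

G→C₅ : All (λ e → Adj C₅ (toC₅ (proj₁ e)) (toC₅ (proj₂ e))) edges
G→C₅ = toWitness {a? = All.all? (λ e → adj C₅ (toC₅ (proj₁ e)) (toC₅ (proj₂ e)) Bool.≟ true) edges} _

positions-injective : InjectiveBelow 164
positions-injective {k} k<164 {l} l<164 eq = begin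
  k                      ≡⟨ indexOf-position k<164 ⟨
  indexOf (positionOf k) ≡⟨ cong indexOf eq ⟩
  indexOf (positionOf l) ≡⟨ indexOf-position l<164 ⟩
  l                      ∎
  where
  open ≡-Reasoning
  indexOf : IntPoint → ℕ
  indexOf p = length (takeWhile (λ q → ¬? (≡-dec ℤ._≟_ ℤ._≟_ q p)) (applyUpTo positionOf 164))
  indexOf-position : ∀ {k} → k ℕ.< 164 → indexOf (positionOf k) ≡ k
  indexOf-position = toWitness {a? = allUpTo? (λ k → indexOf (positionOf k) ℕ.≟ k) 164} _

vertices-off-edges : VerticesOffEdges 164
vertices-off-edges = toWitness {a? = All.all? (λ e → allUpTo? (λ w →
  w ∈ₑ? e ⊎-dec separated? (segment e) (positionOf w , positionOf w)) 164) edges} _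

edges-compatible : AllPairs Compatible edges
edges-compatible = toWitness {a? = allPairs? (λ e e′ →
  (proj₁ e ∈ₑ? e′ ⊎-dec proj₂ e ∈ₑ? e′) ⊎-dec separated? (segment e) (segment e′)) edges} _

colourLists-unique : ∀ v → Unique (colourList v)
colourLists-unique = toWitness {a? = Fin.all? (λ v → unique? (colourList v))} _
  where open Data.List.Relation.Unary.Unique.DecPropositional ℤ._≟_

gadgets : List (List (Fin 164))
gadgets = map (λ g → take 14 (drop (2 ℕ.+ 14 ℕ.* g) (allFin 164))) (upTo 9)

open ListColouringSearch G colourList

roots-refuted : T (refutes gadgets (# 0 ∷ # 1 ∷ []) [])
roots-refuted = _

theorem1p8 : ∃[ G ] (Planar {164} G × TriangleFree G × ¬ Choosable 3 G)
theorem1p8 = G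
           , graph-planar loopless positions-injective vertices-off-edges edges-compatible
           , homomorphism-triangleFree (graph-homomorphism edges 164 loopless C₅ toC₅ G→C₅) C₅-triangleFree
           , λ choosable → no-list-colouring gadgets (# 0 ∷ # 1 ∷ []) roots-refuted
                             (choosable colourList (λ _ → refl) colourLists-unique)
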